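{- For every even integer $n\ge 16$, $$\gamma(W_{4,n})=2\left\lfloor\frac{n}{10}\right\rfloor+\begin{cases}0 & n\equiv 0\pmod{10},\\ 2 & n\equiv 2,4\pmod{10}.\end{cases}$$
   Context: For an even integer $n\ge 16$, the Kn\"odel graph $W_{4,n}$ is the bipartite graph on the $n$ vertices $(i,j)$, $i\in\{1,2\}$, $0\le j\le n/2-1$, in which, for every $j$, the vertex $(1,j)$ is adjacent exactly to the vertices $(2,(j+2^k-1)\bmod (n/2))$ for $k=0,1,2,3$. A set $D$ of vertices of a graph $G$ is dominating if every vertex not in $D$ is adjacent to some vertex of $D$; $\gamma(G)$ denotes the minimum size of a dominating set. (The statement concerns only those $n$ with $n\equiv 0,2,4 \pmod{10}$.) -}

module Defs where

open import Data.Nat using (ℕ; _+_; _*_; _∸_; _^_; _≤_)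
open import Data.Fin using (Fin; zero; suc; toℕ)
open import Data.Product using (_×_; ∃; ∃-syntax; _,_)
open import Data.Sum using (_⊎_)
open import Data.Empty using (⊥)
open import Data.List using (List; length)
open import Data.List.Membership.Propositional using (_∈_)
open import Data.List.Relation.Unary.Unique.Propositional using (Unique)
open import Relation.Binary.PropositionalEquality using (_≡_)

-- Vertex (i , j) of W_{4,n}, with m = n/2: i : Fin 2 (zero ↦ 1, suc zero ↦ 2), j : Fin m.
Vertex : ℕ → Set
Vertex m = Fin 2 × Fin m

-- j' = (j + 2^k - 1) mod m for some k ∈ {0,1,2,3}; the "mod m" is written out
-- via the division identity  j + 2^k - 1 = q*m + j'  with 0 ≤ j' < m (j' : Fin m).
KStep : (m : ℕ) → Fin m → Fin m → Set
KStep m j j' = ∃[ k ] ∃[ q ] (toℕ j + 2 ^ toℕ {4} k ∸ 1 ≡ q * m + toℕ j')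

W4Adj : (m : ℕ) → Vertex m → Vertex m → Set
W4Adj m (zero , j) (suc zero , j') = KStep m j j'
W4Adj m (suc zero , j') (zero , j) = KStep m j j'
W4Adj m _ _ = ⊥

IsDominating : {V : Set} → (V → V → Set) → List V → Set
IsDominating {V} Adj D = ∀ (v : V) → v ∈ D ⊎ ∃[ u ] (u ∈ D × Adj u v)

DominationNumberIs : {V : Set} → (V → V → Set) → ℕ → Set
DominationNumberIs {V} Adj g =
  (∃[ D ] (Unique D × IsDominating Adj D × length D ≡ g))
  × (∀ (D : List V) → Unique D → IsDominating Adj D → g ≤ length D)

module Submission where

-- Let m = n/2. A dominating set is a pair of index sets A (side 1) and B (side 2) of Z/m,
-- and (1, a) is adjacent to (2, a + o) for o ∈ {0, 1, 3, 7}. Counting the side-2 vertices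
-- gives m ≤ |B| + 4|A|, and v ↦ −v, which swaps the sides, gives m ≤ |A| + 4|B|. These two
-- bounds alone give the lower bound when m ≡ 0 or 2 (mod 5). When m = 5q + 1 they leave
-- one case, |A| = q and |B| = q + 1 (or symmetrically), where every side-2 vertex is
-- dominated exactly once. Then each a ∈ A forces a + 4 ∈ B and either a + 5 ∈ A or
-- a + 5, a + 6 ∈ B; the progression a, a + 5, … must meet the second alternative, and then
-- a ↦ a + 4 maps A into B while missing a + 5 and a + 6, so |B| ≥ |A| + 2.
-- The upper bounds come from the sets (1, 5i), (2, 5i + 4), with one extra vertex when
-- 5 ∤ m.

open import Data.Empty using (⊥; ⊥-elim)
open import Data.Fin as Fin using (Fin; toℕ; fromℕ<; #_)
open import Data.Fin.Properties using (toℕ<n; toℕ-fromℕ<; toℕ-injective)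
open import Data.List using (List; []; _∷_; _++_; length; map; allFin; applyUpTo)
open import Data.List.Membership.Propositional using (_∈_)
open import Data.List.Membership.Propositional.Properties
  using (∈-map⁺; ∈-map⁻; ∈-allFin; ∈-applyUpTo⁺; ∈-applyUpTo⁻; ∈-++⁺ˡ; ∈-++⁺ʳ)
open import Data.List.Properties using (length-map; length-++; length-applyUpTo)
open import Data.List.Relation.Unary.All using ([])
open import Data.List.Relation.Unary.AllPairs using ([]; _∷_)
open import Data.List.Relation.Unary.Any using (here; there)
open import Data.List.Relation.Unary.Unique.Propositional using (Unique)
import Data.List.Relation.Unary.Unique.Propositional.Properties as Unique
open import Data.Nat
open import Data.Nat.Divisibility using (_∣_)
open import Data.Nat.DivMod
open import Data.Nat.Properties
open import Data.Nat.Tactic.RingSolver using (solve-∀)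
open import Data.List.Membership.DecPropositional _≟_ using (_∈?_)
open import Data.Product using (_×_; _,_; ∃-syntax; proj₂)
open import Data.Sum using (_⊎_; inj₁; inj₂; [_,_]′)
open import Relation.Binary.PropositionalEquality
open import Relation.Nullary using (yes; no; ¬_)

open import Defs

δ : ℕ → ℕ → ℕ
δ x v with x ≟ v
... | yes _ = 1
... | no _ = 0

δ-refl : ∀ x → δ x x ≡ 1
δ-refl x with x ≟ x
... | yes _ = refl
... | no x≢x = ⊥-elim (x≢x refl)

δ-≢ : ∀ {x v} → x ≢ v → δ x v ≡ 0
δ-≢ {x} {v} x≢v with x ≟ v
... | yes x≡v = ⊥-elim (x≢v x≡v)
... | no _ = refl

sumBelow : ℕ → (ℕ → ℕ) → ℕ
sumBelow zero f = 0
sumBelow (suc k) f = sumBelow k f + f k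

syntax sumBelow k (λ v → e) = ∑[ v < k ] e

sumOver : List ℕ → (ℕ → ℕ) → ℕ
sumOver [] f = 0
sumOver (x ∷ xs) f = f x + sumOver xs f

syntax sumOver xs (λ x → e) = ∑[ x ∈ xs ] e

multiplicity : List ℕ → ℕ → ℕ
multiplicity xs v = ∑[ x ∈ xs ] δ x v

∑<-cong : ∀ {f g} k → (∀ {v} → v < k → f v ≡ g v) → sumBelow k f ≡ sumBelow k g
∑<-cong zero eq = refl
∑<-cong (suc k) eq = cong₂ _+_ (∑<-cong k (λ v<k → eq (m<n⇒m<1+n v<k))) (eq ≤-refl)

∑<-mono : ∀ {f g} k → (∀ {v} → v < k → f v ≤ g v) → sumBelow k f ≤ sumBelow k g
∑<-mono zero le = z≤n
∑<-mono (suc k) le = +-mono-≤ (∑<-mono k (λ v<k → le (m<n⇒m<1+n v<k))) (le ≤-refl)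

∑<-mono-strict : ∀ {f g} k {w} → (∀ {v} → v < k → f v ≤ g v) → w < k → f w < g w →
                 suc (sumBelow k f) ≤ sumBelow k g
∑<-mono-strict {f} {g} (suc k) le w<1+k fw<gw with m≤n⇒m<n∨m≡n (s≤s⁻¹ w<1+k)
... | inj₁ w<k = +-mono-≤ (∑<-mono-strict k (λ v<k → le (m<n⇒m<1+n v<k)) w<k fw<gw) (le ≤-refl)
... | inj₂ refl = subst (_≤ sumBelow (suc k) g) (+-suc (sumBelow k f) (f k))
                        (+-mono-≤ (∑<-mono k (λ v<k → le (m<n⇒m<1+n v<k))) fw<gw)

∑<-mono-strict₂ : ∀ {f g} k {w w'} → (∀ {v} → v < k → f v ≤ g v) → w < k → w' < k → w ≢ w' →
                  f w < g w → f w' < g w' → 2 + sumBelow k f ≤ sumBelow k g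
∑<-mono-strict₂ {f} {g} (suc k) {w} {w'} le w<1+k w'<1+k w≢w' fw<gw fw'<gw'
  with m≤n⇒m<n∨m≡n (s≤s⁻¹ w<1+k) | m≤n⇒m<n∨m≡n (s≤s⁻¹ w'<1+k)
... | inj₁ w<k | inj₁ w'<k = +-mono-≤ (∑<-mono-strict₂ k le′ w<k w'<k w≢w' fw<gw fw'<gw') (le ≤-refl)
  where le′ = λ {v} (v<k : v < k) → le (m<n⇒m<1+n v<k)
... | inj₁ w<k | inj₂ refl = subst (_≤ sumBelow (suc k) g) (cong suc (+-suc (sumBelow k f) (f k)))
                                   (+-mono-≤ (∑<-mono-strict k (λ v<k → le (m<n⇒m<1+n v<k)) w<k fw<gw) fw'<gw')
... | inj₂ refl | inj₁ w'<k = subst (_≤ sumBelow (suc k) g) (cong suc (+-suc (sumBelow k f) (f k)))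
                                   (+-mono-≤ (∑<-mono-strict k (λ v<k → le (m<n⇒m<1+n v<k)) w'<k fw'<gw') fw<gw)
... | inj₂ refl | inj₂ refl = ⊥-elim (w≢w' refl)

∑<-+ : ∀ k f g → (∑[ v < k ] (f v + g v)) ≡ sumBelow k f + sumBelow k g
∑<-+ zero f g = refl
∑<-+ (suc k) f g = begin
  (∑[ v < k ] (f v + g v)) + (f k + g k)   ≡⟨ cong (_+ (f k + g k)) (∑<-+ k f g) ⟩
  (sumBelow k f + sumBelow k g) + (f k + g k) ≡⟨ +-assoc (sumBelow k f) _ _ ⟩
  sumBelow k f + (sumBelow k g + (f k + g k)) ≡⟨ cong (sumBelow k f +_) (+-comm (sumBelow k g) _) ⟩
  sumBelow k f + ((f k + g k) + sumBelow k g) ≡⟨ cong (sumBelow k f +_) (+-assoc (f k) _ _) ⟩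
  sumBelow k f + (f k + (g k + sumBelow k g)) ≡⟨ sym (+-assoc (sumBelow k f) _ _) ⟩
  (sumBelow k f + f k) + (g k + sumBelow k g) ≡⟨ cong ((sumBelow k f + f k) +_) (+-comm (g k) _) ⟩
  (sumBelow k f + f k) + (sumBelow k g + g k) ∎
  where open ≡-Reasoning

∑<-const : ∀ k c → (∑[ v < k ] c) ≡ k * c
∑<-const zero c = refl
∑<-const (suc k) c = trans (cong (_+ c) (∑<-const k c)) (+-comm (k * c) c)

∑<-shiftˡ : ∀ k f → sumBelow (suc k) f ≡ f 0 + (∑[ v < k ] f (suc v))
∑<-shiftˡ zero f = +-comm 0 (f 0)
∑<-shiftˡ (suc k) f = trans (cong (_+ f (suc k)) (∑<-shiftˡ k f)) (+-assoc (f 0) _ _)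

∑<-δ-out : ∀ {k x} → k ≤ x → (∑[ v < k ] δ x v) ≡ 0
∑<-δ-out {zero} _ = refl
∑<-δ-out {suc k} k<x = cong₂ _+_ (∑<-δ-out (<⇒≤ k<x)) (δ-≢ (>⇒≢ k<x))

∑<-δ≡1 : ∀ {k x} → x < k → (∑[ v < k ] δ x v) ≡ 1
∑<-δ≡1 {suc k} x<1+k with m≤n⇒m<n∨m≡n (s≤s⁻¹ x<1+k)
... | inj₁ x<k = cong₂ _+_ (∑<-δ≡1 x<k) (δ-≢ (<⇒≢ x<k))
... | inj₂ refl = cong₂ _+_ (∑<-δ-out {k} ≤-refl) (δ-refl k)

∑<-δ≤1 : ∀ k x → (∑[ v < k ] δ x v) ≤ 1
∑<-δ≤1 k x with x <? k
... | yes x<k = ≤-reflexive (∑<-δ≡1 x<k)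
... | no x≮k = ≤-trans (≤-reflexive (∑<-δ-out (≮⇒≥ x≮k))) z≤n

∑∈-mono : ∀ {f g} xs → (∀ {x} → x ∈ xs → f x ≤ g x) → sumOver xs f ≤ sumOver xs g
∑∈-mono [] le = z≤n
∑∈-mono (x ∷ xs) le = +-mono-≤ (le (here refl)) (∑∈-mono xs (λ x∈xs → le (there x∈xs)))

∑∈-const : ∀ xs c → (∑[ x ∈ xs ] c) ≡ length xs * c
∑∈-const [] c = refl
∑∈-const (x ∷ xs) c = cong (c +_) (∑∈-const xs c)

∑∈-member : ∀ f {xs x} → x ∈ xs → f x ≤ sumOver xs f
∑∈-member f (here refl) = m≤m+n _ _
∑∈-member f (there x∈xs) = ≤-trans (∑∈-member f x∈xs) (m≤n+m _ _)

∑∈-two : ∀ f {xs x y} → x ∈ xs → y ∈ xs → x ≢ y → f x + f y ≤ sumOver xs f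
∑∈-two f (here refl) (here refl) x≢y = ⊥-elim (x≢y refl)
∑∈-two f (here refl) (there y∈xs) _ = +-monoʳ-≤ _ (∑∈-member f y∈xs)
∑∈-two f {xs = _ ∷ xs} {x} {y} (there x∈xs) (here refl) _ =
  subst (_≤ f y + sumOver xs f) (+-comm (f y) (f x)) (+-monoʳ-≤ (f y) (∑∈-member f x∈xs))
∑∈-two f (there x∈xs) (there y∈xs) x≢y = ≤-trans (∑∈-two f x∈xs y∈xs x≢y) (m≤n+m _ _)

∑<-∑∈-comm : ∀ k xs (F : ℕ → ℕ → ℕ) →
             (∑[ v < k ] (∑[ x ∈ xs ] F x v)) ≡ (∑[ x ∈ xs ] (∑[ v < k ] F x v))
∑<-∑∈-comm k [] F = trans (∑<-const k 0) (*-zeroʳ k)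
∑<-∑∈-comm k (x ∷ xs) F = trans (∑<-+ k (F x) _) (cong (sumBelow k (F x) +_) (∑<-∑∈-comm k xs F))

multiplicity-∈ : ∀ {xs v} → v ∈ xs → 1 ≤ multiplicity xs v
multiplicity-∈ {v = v} v∈xs = ≤-trans (≤-reflexive (sym (δ-refl v))) (∑∈-member (λ x → δ x v) v∈xs)

multiplicity-pos⇒∈ : ∀ xs {v} → 1 ≤ multiplicity xs v → v ∈ xs
multiplicity-pos⇒∈ (x ∷ xs) {v} pos with x ≟ v
... | yes refl = here refl
... | no _ = there (multiplicity-pos⇒∈ xs pos)

multiplicity-∉ : ∀ xs {v} → ¬ v ∈ xs → multiplicity xs v ≡ 0
multiplicity-∉ xs v∉xs = n<1⇒n≡0 (≰⇒> (λ pos → v∉xs (multiplicity-pos⇒∈ xs pos)))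

∑<-multiplicity≤length : ∀ k xs → (∑[ v < k ] multiplicity xs v) ≤ length xs
∑<-multiplicity≤length k [] = ≤-reflexive (trans (∑<-const k 0) (*-zeroʳ k))
∑<-multiplicity≤length k (x ∷ xs) =
  ≤-trans (≤-reflexive (∑<-+ k (δ x) (multiplicity xs))) (+-mono-≤ (∑<-δ≤1 k x) (∑<-multiplicity≤length k xs))

∑<-multiplicity≡length : ∀ k xs → (∀ {x} → x ∈ xs → x < k) → (∑[ v < k ] multiplicity xs v) ≡ length xs
∑<-multiplicity≡length k [] _ = trans (∑<-const k 0) (*-zeroʳ k)
∑<-multiplicity≡length k (x ∷ xs) bounded =
  trans (∑<-+ k (δ x) (multiplicity xs))
        (cong₂ _+_ (∑<-δ≡1 (bounded (here refl))) (∑<-multiplicity≡length k xs (λ x∈xs → bounded (there x∈xs))))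

nonempty⇒∈ : ∀ {xs : List ℕ} → 1 ≤ length xs → ∃[ x ] x ∈ xs
nonempty⇒∈ {x ∷ _} _ = x , here refl

module Modular (m' : ℕ) where

  m : ℕ
  m = suc m'

  infix 4 _≡ₘ_
  _≡ₘ_ : ℕ → ℕ → Set
  x ≡ₘ y = x % m ≡ y % m

  %≡ₘ : ∀ x → x % m ≡ₘ x
  %≡ₘ x = m%n%n≡m%n x m

  <⇒%≡ : ∀ {x} → x < m → x % m ≡ x
  <⇒%≡ = m<n⇒m%n≡m

  ≡ₘ-+ʳ : ∀ x y c → x ≡ₘ y → x + c ≡ₘ y + c
  ≡ₘ-+ʳ x y c x≡y = begin
    (x + c) % m                 ≡⟨ %-distribˡ-+ x c m ⟩
    (x % m + c % m) % m         ≡⟨ cong (λ z → (z + c % m) % m) x≡y ⟩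
    (y % m + c % m) % m         ≡⟨ %-distribˡ-+ y c m ⟨
    (y + c) % m                 ∎
    where open ≡-Reasoning

  ≡ₘ-+ˡ : ∀ c x y → x ≡ₘ y → c + x ≡ₘ c + y
  ≡ₘ-+ˡ c x y eq = subst₂ _≡ₘ_ (+-comm x c) (+-comm y c) (≡ₘ-+ʳ x y c eq)

  [%+]%≡[+]% : ∀ x c → (x % m + c) % m ≡ (x + c) % m
  [%+]%≡[+]% x c = ≡ₘ-+ʳ (x % m) x c (%≡ₘ x)

  +-mulₘ : ∀ x c → x + c + c * m' ≡ₘ x
  +-mulₘ x c = trans (cong (_% m) (trans (+-assoc x c _) (cong (x +_) (sym (*-suc c m')))))
                     ([m+kn]%n≡m%n x c m)

  ≡ₘ-cancelʳ : ∀ x y c → x + c ≡ₘ y + c → x ≡ₘ y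
  ≡ₘ-cancelʳ x y c x+c≡y+c =
    trans (sym (+-mulₘ x c)) (trans (≡ₘ-+ʳ (x + c) (y + c) (c * m') x+c≡y+c) (+-mulₘ y c))

  ≡ₘ⇒≡ : ∀ x y → x < m → y < m → x ≡ₘ y → x ≡ y
  ≡ₘ⇒≡ x y x<m y<m x≡y = trans (sym (<⇒%≡ x<m)) (trans x≡y (<⇒%≡ y<m))

  ≡ₘ-cancelˡ : ∀ x i j → i < m → j < m → x + i ≡ₘ x + j → i ≡ j
  ≡ₘ-cancelˡ x i j i<m j<m x+i≡x+j =
    ≡ₘ⇒≡ i j i<m j<m (≡ₘ-cancelʳ i j x (subst₂ _≡ₘ_ (+-comm x i) (+-comm x j) x+i≡x+j))

  ≡ₘ-shift : ∀ x y i j d → x + i ≡ₘ y + j → x + (i + d) ≡ₘ y + (j + d)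
  ≡ₘ-shift x y i j d eq =
    subst₂ _≡ₘ_ (+-assoc x i d) (+-assoc y j d) (≡ₘ-+ʳ (x + i) (y + j) d eq)

  ≡ₘ-unshift : ∀ x y i j d → x + (i + d) ≡ₘ y + (j + d) → x + i ≡ₘ y + j
  ≡ₘ-unshift x y i j d eq =
    ≡ₘ-cancelʳ (x + i) (y + j) d (subst₂ _≡ₘ_ (sym (+-assoc x i d)) (sym (+-assoc y j d)) eq)

  ∑<-rotate₁ : ∀ h → (∑[ v < m ] h ((v + 1) % m)) ≡ sumBelow m h
  ∑<-rotate₁ h = begin
    (∑[ v < m' ] h ((v + 1) % m)) + h ((m' + 1) % m)
      ≡⟨ cong₂ _+_ (∑<-cong m' (λ {v} v<m' → cong h (trans (cong (_% m) (+-comm v 1)) (<⇒%≡ (s≤s v<m')))))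
                   (cong h (trans (cong (_% m) (+-comm m' 1)) (n%n≡0 m))) ⟩
    (∑[ v < m' ] h (suc v)) + h 0   ≡⟨ +-comm _ (h 0) ⟩
    h 0 + (∑[ v < m' ] h (suc v))   ≡⟨ ∑<-shiftˡ m' h ⟨
    sumBelow m h                    ∎
    where open ≡-Reasoning

  ∑<-rotate : ∀ h c → (∑[ v < m ] h ((v + c) % m)) ≡ sumBelow m h
  ∑<-rotate h zero = ∑<-cong m (λ {v} v<m → cong h (trans (cong (_% m) (+-identityʳ v)) (<⇒%≡ v<m)))
  ∑<-rotate h (suc c) = begin
    (∑[ v < m ] h ((v + suc c) % m))          ≡⟨ ∑<-cong m (λ {v} _ → cong h (step v)) ⟩
    (∑[ v < m ] h (((v + 1) % m + c) % m))    ≡⟨ ∑<-rotate₁ (λ u → h ((u + c) % m)) ⟩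
    (∑[ v < m ] h ((v + c) % m))              ≡⟨ ∑<-rotate h c ⟩
    sumBelow m h                              ∎
    where
    open ≡-Reasoning
    step : ∀ v → (v + suc c) % m ≡ ((v + 1) % m + c) % m
    step v = trans (cong (_% m) (trans (+-suc v c) (cong (_+ c) (+-comm 1 v)))) (sym ([%+]%≡[+]% (v + 1) c))

  neg : ℕ → ℕ
  neg x = (m ∸ x) % m

  neg<m : ∀ x → neg x < m
  neg<m x = m%n<n (m ∸ x) m

  neg-+ : ∀ {x} → x ≤ m → neg x + x ≡ₘ 0
  neg-+ {x} x≤m = trans ([%+]%≡[+]% (m ∸ x) x) (trans (cong (_% m) (m∸n+n≡m x≤m)) (n%n≡0 m))

  neg-involutive : ∀ {v} → v < m → neg (neg v) ≡ v
  neg-involutive {v} v<m = ≡ₘ⇒≡ (neg (neg v)) v (neg<m (neg v)) v<m (≡ₘ-cancelʳ (neg (neg v)) v (neg v)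
    (trans (neg-+ (<⇒≤ (neg<m v))) (sym (trans (cong (_% m) (+-comm v (neg v))) (neg-+ (<⇒≤ v<m))))))

-- Counting the side-2 vertices covered

offset : Fin 4 → ℕ
offset k = 2 ^ toℕ k ∸ 1

offset<8 : ∀ k → offset k < 8
offset<8 Fin.zero = s≤s z≤n
offset<8 (Fin.suc Fin.zero) = s≤s (s≤s z≤n)
offset<8 (Fin.suc (Fin.suc Fin.zero)) = s≤s (s≤s (s≤s (s≤s z≤n)))
offset<8 (Fin.suc (Fin.suc (Fin.suc Fin.zero))) = ≤-refl

module Covering (m' : ℕ) where
  open Modular m' public

  -- (1, a) is adjacent to (2, a + offset k mod m); a dominating set is handled through the
  -- index lists A of its side-1 vertices and B of its side-2 vertices.

  neighbours : ℕ → List ℕ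
  neighbours a = map (λ k → (a + offset k) % m) (allFin 4)

  ∈-neighbours : ∀ a k → (a + offset k) % m ∈ neighbours a
  ∈-neighbours a k = ∈-map⁺ (λ k → (a + offset k) % m) (∈-allFin k)

  Dominates₂ : List ℕ → List ℕ → Set
  Dominates₂ A B = ∀ {v} → v < m → v ∈ B ⊎ ∃[ a ] ∃[ k ] (a ∈ A × (a + offset k) % m ≡ v)

  coverCount : List ℕ → List ℕ → ℕ → ℕ
  coverCount A B v = multiplicity B v + ∑[ a ∈ A ] multiplicity (neighbours a) v

  coverCount-neighbour : ∀ {A} B {a v} k → a ∈ A → (a + offset k) % m ≡ v → 1 ≤ coverCount A B v
  coverCount-neighbour B {a} {v} k a∈A eq =
    ≤-trans (multiplicity-∈ (subst (_∈ neighbours a) eq (∈-neighbours a k)))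
            (≤-trans (∑∈-member (λ a → multiplicity (neighbours a) v) a∈A) (m≤n+m _ _))

  coverCount-pos : ∀ {A B} → Dominates₂ A B → ∀ {v} → v < m → 1 ≤ coverCount A B v
  coverCount-pos {A} {B} dom v<m with dom v<m
  ... | inj₁ v∈B = ≤-trans (multiplicity-∈ v∈B) (m≤m+n _ _)
  ... | inj₂ (a , k , a∈A , eq) = coverCount-neighbour B k a∈A eq

  ∑<-coverCount : ∀ A B → (∑[ v < m ] coverCount A B v) ≤ length B + 4 * length A
  ∑<-coverCount A B = begin
    (∑[ v < m ] coverCount A B v)
      ≡⟨ ∑<-+ m (multiplicity B) _ ⟩
    (∑[ v < m ] multiplicity B v) + (∑[ v < m ] (∑[ a ∈ A ] multiplicity (neighbours a) v))
      ≡⟨ cong (_ +_) (∑<-∑∈-comm m A (λ a → multiplicity (neighbours a))) ⟩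
    (∑[ v < m ] multiplicity B v) + (∑[ a ∈ A ] (∑[ v < m ] multiplicity (neighbours a) v))
      ≤⟨ +-mono-≤ (∑<-multiplicity≤length m B) (∑∈-mono A (λ {a} _ → ∑<-multiplicity≤length m (neighbours a))) ⟩
    length B + (∑[ a ∈ A ] 4)
      ≡⟨ cong (length B +_) (trans (∑∈-const A 4) (*-comm (length A) 4)) ⟩
    length B + 4 * length A ∎
    where open ≤-Reasoning

  dominates₂⇒m≤ : ∀ {A B} → Dominates₂ A B → m ≤ length B + 4 * length A
  dominates₂⇒m≤ {A} {B} dom = begin
    m                              ≡⟨ sym (trans (∑<-const m 1) (*-identityʳ m)) ⟩
    (∑[ v < m ] 1)                 ≤⟨ ∑<-mono m (coverCount-pos dom) ⟩
    (∑[ v < m ] coverCount A B v)  ≤⟨ ∑<-coverCount A B ⟩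
    length B + 4 * length A        ∎
    where open ≤-Reasoning

  offset<m : 8 ≤ m → ∀ k → offset k < m
  offset<m 8≤m k = ≤-trans (offset<8 k) 8≤m

  coverCount-two-neighbours : ∀ {A} B {a a' w} → a ∈ A → a' ∈ A → a ≢ a' →
                              w ∈ neighbours a → w ∈ neighbours a' → 2 ≤ coverCount A B w
  coverCount-two-neighbours B {a} {a'} {w} a∈A a'∈A a≢a' w∼a w∼a' =
    ≤-trans (+-mono-≤ (multiplicity-∈ w∼a) (multiplicity-∈ w∼a'))
            (≤-trans (∑∈-two (λ x → multiplicity (neighbours x) w) a∈A a'∈A a≢a') (m≤n+m _ _))

  coverCount-B-neighbour : ∀ {A B a b} → a ∈ A → b ∈ B → b ∈ neighbours a → 2 ≤ coverCount A B b
  coverCount-B-neighbour {a = a} {b} a∈A b∈B b∼a =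
    +-mono-≤ (multiplicity-∈ b∈B)
             (≤-trans (multiplicity-∈ b∼a) (∑∈-member (λ x → multiplicity (neighbours x) b) a∈A))

  multiplicity≤coverCount : ∀ {A} B → (∀ {a} → a ∈ A → a < m) → ∀ v → multiplicity A v ≤ coverCount A B v
  multiplicity≤coverCount {A} B A<m v =
    ≤-trans (∑∈-mono A δ≤neighbours) (m≤n+m _ (multiplicity B v))
    where
    δ≤neighbours : ∀ {a} → a ∈ A → δ a v ≤ multiplicity (neighbours a) v
    δ≤neighbours {a} a∈A with a ≟ v
    ... | no _ = z≤n
    ... | yes refl = multiplicity-∈ (subst (_∈ neighbours a) (trans (cong (_% m) (+-identityʳ a)) (<⇒%≡ (A<m a∈A)))
                                           (∈-neighbours a (# 0)))

  module ExactCover (8≤m : 8 ≤ m) {A B : List ℕ}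
                    (A<m : ∀ {a} → a ∈ A → a < m) (B<m : ∀ {b} → b ∈ B → b < m)
                    (dom : Dominates₂ A B) (exact : length B + 4 * length A ≡ m) where

    no-double-cover : ∀ {w} → w < m → 2 ≤ coverCount A B w → ⊥
    no-double-cover {w} w<m 2≤cover = <-irrefl refl (begin-strict
      m                              ≡⟨ sym (trans (∑<-const m 1) (*-identityʳ m)) ⟩
      (∑[ v < m ] 1)                 <⟨ ∑<-mono-strict m (coverCount-pos dom) w<m 2≤cover ⟩
      (∑[ v < m ] coverCount A B v)  ≤⟨ ∑<-coverCount A B ⟩
      length B + 4 * length A        ≡⟨ exact ⟩
      m                              ∎)
      where open ≤-Reasoning

    no-collision : ∀ {a a'} k k' → a ∈ A → a' ∈ A → offset k ≢ offset k' →
                   a + offset k ≡ₘ a' + offset k' → ⊥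
    no-collision {a} {a'} k k' a∈A a'∈A k≢k' eq with a ≟ a'
    ... | yes refl = k≢k' (≡ₘ-cancelˡ a (offset k) (offset k') (offset<m 8≤m k) (offset<m 8≤m k') eq)
    ... | no a≢a' = no-double-cover (m%n<n (a + offset k) m)
          (coverCount-two-neighbours B a∈A a'∈A a≢a' (∈-neighbours a k)
                                     (subst (_∈ neighbours a') (sym eq) (∈-neighbours a' k')))

    no-B-neighbour : ∀ {a b} k → a ∈ A → b ∈ B → b ≡ₘ a + offset k → ⊥
    no-B-neighbour {a} {b} k a∈A b∈B eq = no-double-cover (B<m b∈B)
      (coverCount-B-neighbour a∈A b∈B (subst (_∈ neighbours a) (trans (sym eq) (<⇒%≡ (B<m b∈B))) (∈-neighbours a k)))

    -- Each impossible case makes a' − a a difference of two distinct offsets, so that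
    -- a and a' share a neighbour; the same pattern recurs in the next two lemmas.
    +4∈B : ∀ {a} → a ∈ A → (a + 4) % m ∈ B
    +4∈B {a} a∈A with dom (m%n<n (a + 4) m)
    ... | inj₁ a+4∈B = a+4∈B
    ... | inj₂ (a' , Fin.zero , a'∈A , eq) =
      ⊥-elim (no-collision (# 2) (# 3) a'∈A a∈A (λ ()) (≡ₘ-shift a' a 0 4 3 eq))
    ... | inj₂ (a' , Fin.suc Fin.zero , a'∈A , eq) =
      ⊥-elim (no-collision (# 0) (# 2) a'∈A a∈A (λ ()) (≡ₘ-unshift a' a 0 3 1 eq))
    ... | inj₂ (a' , Fin.suc (Fin.suc Fin.zero) , a'∈A , eq) =
      ⊥-elim (no-collision (# 0) (# 1) a'∈A a∈A (λ ()) (≡ₘ-unshift a' a 0 1 3 eq))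
    ... | inj₂ (a' , Fin.suc (Fin.suc (Fin.suc Fin.zero)) , a'∈A , eq) =
      ⊥-elim (no-collision (# 2) (# 0) a'∈A a∈A (λ ()) (≡ₘ-unshift a' a 3 0 4 eq))

    +6∈B : ∀ {a} → a ∈ A → (a + 5) % m ∈ B → (a + 6) % m ∈ B
    +6∈B {a} a∈A a+5∈B with dom (m%n<n (a + 6) m)
    ... | inj₁ a+6∈B = a+6∈B
    ... | inj₂ (a' , Fin.zero , a'∈A , eq) =
      ⊥-elim (no-collision (# 1) (# 3) a'∈A a∈A (λ ()) (≡ₘ-shift a' a 0 6 1 eq))
    ... | inj₂ (a' , Fin.suc Fin.zero , a'∈A , eq) =
      ⊥-elim (no-B-neighbour (# 0) a'∈A a+5∈B (trans (%≡ₘ (a + 5)) (sym (≡ₘ-unshift a' a 0 5 1 eq))))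
    ... | inj₂ (a' , Fin.suc (Fin.suc Fin.zero) , a'∈A , eq) =
      ⊥-elim (no-collision (# 0) (# 2) a'∈A a∈A (λ ()) (≡ₘ-unshift a' a 0 3 3 eq))
    ... | inj₂ (a' , Fin.suc (Fin.suc (Fin.suc Fin.zero)) , a'∈A , eq) =
      ⊥-elim (no-collision (# 1) (# 0) a'∈A a∈A (λ ()) (≡ₘ-unshift a' a 1 0 6 eq))

    +5∈A⊎+5,+6∈B : ∀ {a} → a ∈ A → (a + 5) % m ∈ A ⊎ ((a + 5) % m ∈ B × (a + 6) % m ∈ B)
    +5∈A⊎+5,+6∈B {a} a∈A with dom (m%n<n (a + 5) m)
    ... | inj₁ a+5∈B = inj₂ (a+5∈B , +6∈B a∈A a+5∈B)
    ... | inj₂ (a' , Fin.zero , a'∈A , eq) =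
      inj₁ (subst (_∈ A) (trans (sym (<⇒%≡ (A<m a'∈A))) (trans (cong (_% m) (sym (+-identityʳ a'))) eq)) a'∈A)
    ... | inj₂ (a' , Fin.suc Fin.zero , a'∈A , eq) =
      ⊥-elim (no-collision (# 2) (# 3) a'∈A a∈A (λ ()) (≡ₘ-shift a' a 1 5 2 eq))
    ... | inj₂ (a' , Fin.suc (Fin.suc Fin.zero) , a'∈A , eq) =
      ⊥-elim (no-collision (# 1) (# 2) a'∈A a∈A (λ ()) (≡ₘ-unshift a' a 1 3 2 eq))
    ... | inj₂ (a' , Fin.suc (Fin.suc (Fin.suc Fin.zero)) , a'∈A , eq) =
      ⊥-elim (no-collision (# 2) (# 1) a'∈A a∈A (λ ()) (≡ₘ-unshift a' a 3 1 4 eq))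

    coverCount≤1 : ∀ {w} → w < m → coverCount A B w ≤ 1
    coverCount≤1 w<m with 2 ≤? coverCount A B _
    ... | yes 2≤cover = ⊥-elim (no-double-cover w<m 2≤cover)
    ... | no 2≰cover = s≤s⁻¹ (≰⇒> 2≰cover)

    Gap : Set
    Gap = ∃[ a ] (a ∈ A × (a + 5) % m ∈ B × (a + 6) % m ∈ B)

    progression : ∀ {a} → a ∈ A → ∀ t → (a + 5 * t) % m ∈ A ⊎ Gap
    progression {a} a∈A zero = inj₁ (subst (_∈ A) (trans (sym (<⇒%≡ (A<m a∈A))) (cong (_% m) (sym (+-identityʳ a)))) a∈A)
    progression {a} a∈A (suc t) with progression a∈A t
    ... | inj₂ gap = inj₂ gap
    ... | inj₁ aₜ∈A with +5∈A⊎+5,+6∈B aₜ∈A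
    ...   | inj₂ (+5∈B , +6∈B) = inj₂ (_ , aₜ∈A , +5∈B , +6∈B)
    ...   | inj₁ +5∈A = inj₁ (subst (_∈ A) next +5∈A)
      where
      next : ((a + 5 * t) % m + 5) % m ≡ (a + 5 * suc t) % m
      next = trans ([%+]%≡[+]% (a + 5 * t) 5)
                   (cong (_% m) (trans (+-assoc a (5 * t) 5) (cong (a +_) (trans (+-comm (5 * t) 5) (sym (*-suc 5 t))))))

    -- When m = 1 + 5|A|, walking along A in steps of 5 wraps around to a − 1, which
    -- collides with a; so the walk must stop at a gap.
    gap : m ≡ suc (5 * length A) → ∀ {a} → a ∈ A → Gap
    gap m≡ {a} a∈A with progression a∈A (length A)
    ... | inj₂ g = g
    ... | inj₁ a-1∈A = ⊥-elim (no-collision (# 1) (# 0) a-1∈A a∈A (λ ()) wrap)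
      where
      wrap : (a + 5 * length A) % m + 1 ≡ₘ a + 0
      wrap = trans ([%+]%≡[+]% (a + 5 * length A) 1)
        (trans (cong (_% m) (trans (+-assoc a _ 1) (cong (a +_) (trans (+-comm _ 1) (sym m≡)))))
          (trans ([m+n]%n≡m%n a m) (cong (_% m) (sym (+-identityʳ a)))))

    gap⇒|A|+2≤|B| : Gap → 2 + length A ≤ length B
    gap⇒|A|+2≤|B| (a , a∈A , a+5∈B , a+6∈B) = begin
      2 + length A                            ≡⟨ cong (2 +_) (∑<-multiplicity≡length m A A<m) ⟨
      2 + (∑[ v < m ] multiplicity A v)       ≤⟨ ∑<-mono-strict₂ m A→B+4 (m%n<n (a + 1) m) (m%n<n (a + 2) m) w₁≢w₂
                                                  (emptied 1 (# 0) (# 1) (λ ()) refl a+5∈B)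
                                                  (emptied 2 (# 1) (# 2) (λ ()) refl a+6∈B) ⟩
      (∑[ v < m ] multiplicity B ((v + 4) % m)) ≡⟨ ∑<-rotate (multiplicity B) 4 ⟩
      (∑[ v < m ] multiplicity B v)           ≤⟨ ∑<-multiplicity≤length m B ⟩
      length B                                ∎
      where
      open ≤-Reasoning
      A→B+4 : ∀ {v} → v < m → multiplicity A v ≤ multiplicity B ((v + 4) % m)
      A→B+4 {v} v<m with v ∈? A
      ... | no v∉A = ≤-trans (≤-reflexive (multiplicity-∉ A v∉A)) z≤n
      ... | yes v∈A = ≤-trans (≤-trans (multiplicity≤coverCount B A<m v) (coverCount≤1 v<m))
                              (multiplicity-∈ (+4∈B v∈A))
      a+d∉A : ∀ d k k' → offset k ≢ offset k' → d + offset k ≡ offset k' → ¬ (a + d) % m ∈ A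
      a+d∉A d k k' k≢k' d+k≡k' a+d∈A = no-collision k k' a+d∈A a∈A k≢k' (begin-equality
        ((a + d) % m + offset k) % m  ≡⟨ [%+]%≡[+]% (a + d) (offset k) ⟩
        (a + d + offset k) % m        ≡⟨ cong (_% m) (trans (+-assoc a d _) (cong (a +_) d+k≡k')) ⟩
        (a + offset k') % m           ∎)
      emptied : ∀ d k k' → offset k ≢ offset k' → d + offset k ≡ offset k' → (a + (d + 4)) % m ∈ B →
                multiplicity A ((a + d) % m) < multiplicity B (((a + d) % m + 4) % m)
      emptied d k k' k≢k' d+k≡k' a+d+4∈B = begin-strict
        multiplicity A ((a + d) % m)           ≡⟨ multiplicity-∉ A (a+d∉A d k k' k≢k' d+k≡k') ⟩
        0                                      <⟨ multiplicity-∈ (subst (_∈ B) shift a+d+4∈B) ⟩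
        multiplicity B (((a + d) % m + 4) % m) ∎
        where
        shift : (a + (d + 4)) % m ≡ ((a + d) % m + 4) % m
        shift = sym (trans ([%+]%≡[+]% (a + d) 4) (cong (_% m) (+-assoc a d 4)))
      w₁≢w₂ : (a + 1) % m ≢ (a + 2) % m
      w₁≢w₂ eq = 1≢2 (≡ₘ-cancelˡ a 1 2 (≤-trans (s≤s (s≤s z≤n)) 8≤m)
                                       (≤-trans (s≤s (s≤s (s≤s z≤n))) 8≤m) eq)
        where
        1≢2 : 1 ≢ 2
        1≢2 ()

    no-exact-cover : m ≡ suc (5 * length A) → ⊥
    no-exact-cover m≡ = 1+n≰n (begin
      2 + length A  ≤⟨ gap⇒|A|+2≤|B| (gap m≡ (proj₂ (nonempty⇒∈ 1≤|A|))) ⟩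
      length B      ≡⟨ +-cancelʳ-≡ (4 * length A) (length B) (suc (length A)) (trans exact m≡) ⟩
      1 + length A  ∎)
      where
      open ≤-Reasoning
      1≤|A| : 1 ≤ length A
      1≤|A| = *-cancelˡ-≤ 5 (≤-trans (m≤m+n 5 2) (s≤s⁻¹ (subst (8 ≤_) m≡ 8≤m)))

  no-tight-cover : ∀ {A B} → 8 ≤ m → (∀ {a} → a ∈ A → a < m) → (∀ {b} → b ∈ B → b < m) → Dominates₂ A B →
                   m ≡ suc (5 * length A) → length B ≢ suc (length A)
  no-tight-cover 8≤m A<m B<m dom m≡ |B|≡ =
    ExactCover.no-exact-cover 8≤m A<m B<m dom (trans (cong (_+ _) |B|≡) (sym m≡)) m≡

side₁ : ∀ {m} → List (Vertex m) → List ℕ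
side₁ [] = []
side₁ ((Fin.zero , j) ∷ D) = toℕ j ∷ side₁ D
side₁ ((Fin.suc _ , _) ∷ D) = side₁ D

side₂ : ∀ {m} → List (Vertex m) → List ℕ
side₂ [] = []
side₂ ((Fin.zero , _) ∷ D) = side₂ D
side₂ ((Fin.suc _ , j) ∷ D) = toℕ j ∷ side₂ D

length-sides : ∀ {m} (D : List (Vertex m)) → length D ≡ length (side₁ D) + length (side₂ D)
length-sides [] = refl
length-sides ((Fin.zero , _) ∷ D) = cong suc (length-sides D)
length-sides ((Fin.suc _ , _) ∷ D) = trans (cong suc (length-sides D)) (sym (+-suc _ _))

∈-side₁ : ∀ {m} {D : List (Vertex m)} {j} → (Fin.zero , j) ∈ D → toℕ j ∈ side₁ D
∈-side₁ {D = (Fin.zero , _) ∷ _} (here refl) = here refl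
∈-side₁ {D = (Fin.zero , _) ∷ _} (there p) = there (∈-side₁ p)
∈-side₁ {D = (Fin.suc _ , _) ∷ _} (there p) = ∈-side₁ p

∈-side₂ : ∀ {m} {D : List (Vertex m)} {j} → (Fin.suc Fin.zero , j) ∈ D → toℕ j ∈ side₂ D
∈-side₂ {D = (Fin.suc _ , _) ∷ _} (here refl) = here refl
∈-side₂ {D = (Fin.zero , _) ∷ _} (there p) = ∈-side₂ p
∈-side₂ {D = (Fin.suc _ , _) ∷ _} (there p) = there (∈-side₂ p)

side₁<m : ∀ {m} (D : List (Vertex m)) {x} → x ∈ side₁ D → x < m
side₁<m ((Fin.zero , j) ∷ D) (here refl) = toℕ<n j
side₁<m ((Fin.zero , _) ∷ D) (there p) = side₁<m D p
side₁<m ((Fin.suc _ , _) ∷ D) p = side₁<m D p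

side₂<m : ∀ {m} (D : List (Vertex m)) {x} → x ∈ side₂ D → x < m
side₂<m ((Fin.zero , _) ∷ D) p = side₂<m D p
side₂<m ((Fin.suc _ , j) ∷ D) (here refl) = toℕ<n j
side₂<m ((Fin.suc _ , _) ∷ D) (there p) = side₂<m D p

-- Lower bounds

record DominatingSizes (m a b : ℕ) : Set where
  field
    m≤b+4a : m ≤ b + 4 * a
    m≤a+4b : m ≤ a + 4 * b
    ¬tight₁ : m ≡ suc (5 * a) → b ≢ suc a
    ¬tight₂ : m ≡ suc (5 * b) → a ≢ suc b

module Domination (m' : ℕ) where
  open Covering m' public

  KStep⇒offset : ∀ j j' → KStep m j j' → ∃[ k ] ((toℕ j + offset k) % m ≡ toℕ j')
  KStep⇒offset j j' (k , q , eq) = k , (begin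
    (toℕ j + offset k) % m        ≡⟨ cong (_% m) (+-∸-assoc (toℕ j) (m^n>0 2 (toℕ k))) ⟨
    (toℕ j + 2 ^ toℕ k ∸ 1) % m   ≡⟨ cong (_% m) (trans eq (+-comm (q * m) (toℕ j'))) ⟩
    (toℕ j' + q * m) % m          ≡⟨ [m+kn]%n≡m%n (toℕ j') q m ⟩
    toℕ j' % m                    ≡⟨ <⇒%≡ (toℕ<n j') ⟩
    toℕ j'                        ∎)
    where open ≡-Reasoning

  offset⇒KStep : ∀ j j' k → (toℕ j + offset k) % m ≡ toℕ j' → KStep m j j'
  offset⇒KStep j j' k eq = k , x / m , (begin
    toℕ j + 2 ^ toℕ k ∸ 1   ≡⟨ +-∸-assoc (toℕ j) (m^n>0 2 (toℕ k)) ⟩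
    x                       ≡⟨ m≡m%n+[m/n]*n x m ⟩
    x % m + x / m * m       ≡⟨ +-comm (x % m) _ ⟩
    x / m * m + x % m       ≡⟨ cong (x / m * m +_) eq ⟩
    x / m * m + toℕ j'      ∎)
    where
    open ≡-Reasoning
    x = toℕ j + offset k

  Dominates₁ : List ℕ → List ℕ → Set
  Dominates₁ A B = ∀ {v} → v < m → v ∈ A ⊎ ∃[ b ] ∃[ k ] (b ∈ B × (v + offset k) % m ≡ b)

  module _ {D : List (Vertex m)} (dom : IsDominating (W4Adj m) D) where

    dominating⇒Dominates₂ : Dominates₂ (side₁ D) (side₂ D)
    dominating⇒Dominates₂ {v} v<m with dom (Fin.suc Fin.zero , fromℕ< v<m)
    ... | inj₁ v∈D = inj₁ (subst (_∈ side₂ D) (toℕ-fromℕ< v<m) (∈-side₂ v∈D))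
    ... | inj₂ ((Fin.suc Fin.zero , _) , _ , ())
    ... | inj₂ ((Fin.zero , j) , u∈D , adj) with KStep⇒offset j (fromℕ< v<m) adj
    ...   | k , eq = inj₂ (toℕ j , k , ∈-side₁ u∈D , trans eq (toℕ-fromℕ< v<m))

    dominating⇒Dominates₁ : Dominates₁ (side₁ D) (side₂ D)
    dominating⇒Dominates₁ {v} v<m with dom (Fin.zero , fromℕ< v<m)
    ... | inj₁ v∈D = inj₁ (subst (_∈ side₁ D) (toℕ-fromℕ< v<m) (∈-side₁ v∈D))
    ... | inj₂ ((Fin.zero , _) , _ , ())
    ... | inj₂ ((Fin.suc Fin.zero , j) , u∈D , adj) with KStep⇒offset (fromℕ< v<m) j adj
    ...   | k , eq = inj₂ (toℕ j , k , ∈-side₂ u∈D , trans (cong (λ x → (x + offset k) % m) (sym (toℕ-fromℕ< v<m))) eq)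

  -- v ↦ −v swaps the two sides of W_{4,2m}.
  Dominates₁⇒Dominates₂ : ∀ {A B} → (∀ {b} → b ∈ B → b < m) →
                          Dominates₁ A B → Dominates₂ (map neg B) (map neg A)
  Dominates₁⇒Dominates₂ {A} {B} B<m dom {v} v<m with dom (neg<m v)
  ... | inj₁ -v∈A = inj₁ (subst (_∈ map neg A) (neg-involutive v<m) (∈-map⁺ neg -v∈A))
  ... | inj₂ (b , k , b∈B , eq) =
    inj₂ (neg b , k , ∈-map⁺ neg b∈B , trans (≡ₘ-cancelʳ (neg b + offset k) v (neg v) both≡0) (<⇒%≡ v<m))
    where
    both≡0 : neg b + offset k + neg v ≡ₘ v + neg v
    both≡0 = begin
      (neg b + offset k + neg v) % m   ≡⟨ cong (_% m) (trans (+-assoc (neg b) _ _) (cong (neg b +_) (+-comm (offset k) (neg v)))) ⟩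
      (neg b + (neg v + offset k)) % m ≡⟨ ≡ₘ-+ˡ (neg b) _ b (trans eq (sym (<⇒%≡ (B<m b∈B)))) ⟩
      (neg b + b) % m                  ≡⟨ neg-+ (<⇒≤ (B<m b∈B)) ⟩
      0 % m                            ≡⟨ neg-+ (<⇒≤ v<m) ⟨
      (neg v + v) % m                  ≡⟨ cong (_% m) (+-comm (neg v) v) ⟩
      (v + neg v) % m                  ∎
      where open ≡-Reasoning

  map-neg<m : ∀ {xs x} → x ∈ map neg xs → x < m
  map-neg<m x∈ with ∈-map⁻ neg x∈
  ... | y , _ , refl = neg<m y

  dominating⇒sizes : 8 ≤ m → ∀ {D} → IsDominating (W4Adj m) D →
                     DominatingSizes m (length (side₁ D)) (length (side₂ D))
  dominating⇒sizes 8≤m {D} dom = record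
    { m≤b+4a = dominates₂⇒m≤ dom₂
    ; m≤a+4b = subst₂ (λ a b → m ≤ a + 4 * b) (length-map neg A) (length-map neg B) (dominates₂⇒m≤ dom₂′)
    ; ¬tight₁ = no-tight-cover 8≤m (side₁<m D) (side₂<m D) dom₂
    ; ¬tight₂ = subst₂ (λ a b → m ≡ suc (5 * b) → a ≢ suc b) (length-map neg A) (length-map neg B)
                       (no-tight-cover 8≤m map-neg<m map-neg<m dom₂′)
    }
    where
    A = side₁ D
    B = side₂ D
    dom₂ = dominating⇒Dominates₂ dom
    dom₂′ = Dominates₁⇒Dominates₂ (side₂<m D) (dominating⇒Dominates₁ dom)

module _ {m a b : ℕ} (sizes : DominatingSizes m a b) where
  open DominatingSizes sizes

  2m≤5[a+b] : 2 * m ≤ 5 * (a + b)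
  2m≤5[a+b] = subst₂ _≤_ (identity₁ m) (identity₂ a b) (+-mono-≤ m≤b+4a m≤a+4b)
    where
    identity₁ : ∀ m → m + m ≡ 2 * m
    identity₁ = solve-∀
    identity₂ : ∀ a b → b + 4 * a + (a + 4 * b) ≡ 5 * (a + b)
    identity₂ = solve-∀

  m≤s+3a : ∀ {s} → a + b ≤ s → m ≤ s + 3 * a
  m≤s+3a {s} a+b≤s = begin
    m              ≤⟨ m≤b+4a ⟩
    b + 4 * a      ≡⟨ identity a b ⟩
    a + b + 3 * a  ≤⟨ +-monoˡ-≤ (3 * a) a+b≤s ⟩
    s + 3 * a      ∎
    where
    open ≤-Reasoning
    identity : ∀ a b → b + 4 * a ≡ a + b + 3 * a
    identity = solve-∀

  m≤s+3b : ∀ {s} → a + b ≤ s → m ≤ s + 3 * b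
  m≤s+3b {s} a+b≤s = begin
    m              ≤⟨ m≤a+4b ⟩
    a + 4 * b      ≡⟨ identity a b ⟩
    a + b + 3 * b  ≤⟨ +-monoˡ-≤ (3 * b) a+b≤s ⟩
    s + 3 * b      ∎
    where
    open ≤-Reasoning
    identity : ∀ a b → a + 4 * b ≡ a + b + 3 * b
    identity = solve-∀

sizes-5q : ∀ {q a b} → DominatingSizes (5 * q) a b → 2 * q ≤ a + b
sizes-5q {q} {a} {b} sizes = *-cancelˡ-≤ 5 (begin
  5 * (2 * q)   ≡⟨ identity q ⟩
  2 * (5 * q)   ≤⟨ 2m≤5[a+b] sizes ⟩
  5 * (a + b)   ∎)
  where
  open ≤-Reasoning
  identity : ∀ q → 5 * (2 * q) ≡ 2 * (5 * q)
  identity = solve-∀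

split-2q+1 : ∀ {q a b} → q ≤ a → q ≤ b → a + b ≡ 2 * q + 1 → (a ≡ q × b ≡ suc q) ⊎ (a ≡ suc q × b ≡ q)
split-2q+1 {q} {a} {b} q≤a q≤b a+b≡ with m≤n⇒m<n∨m≡n q≤a
... | inj₂ refl = inj₁ (refl , +-cancelˡ-≡ q b (suc q) (trans a+b≡ (identity q)))
  where
  identity : ∀ q → 2 * q + 1 ≡ q + suc q
  identity = solve-∀
... | inj₁ q<a = inj₂ (+-cancelʳ-≡ q a (suc q) (subst (λ z → a + z ≡ suc q + q) b≡q (trans a+b≡ (identity q))) , b≡q)
  where
  identity : ∀ q → 2 * q + 1 ≡ suc q + q
  identity = solve-∀
  b≡q : b ≡ q
  b≡q = ≤-antisym (+-cancelˡ-≤ (suc q) b q (≤-trans (+-monoˡ-≤ b q<a) (≤-reflexive (trans a+b≡ (identity q))))) q≤b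

sizes-5q+1 : ∀ {q a b} → DominatingSizes (5 * q + 1) a b → 2 * q + 2 ≤ a + b
sizes-5q+1 {q} {a} {b} sizes with 2 * q + 2 ≤? a + b
... | yes ok = ok
... | no a+b≰ = ⊥-elim (not-tight (split-2q+1 (third (m≤s+3a sizes a+b≤)) (third (m≤s+3b sizes a+b≤))
                                             (≤-antisym a+b≤ 2q+1≤a+b)))
  where
  open DominatingSizes sizes
  a+b≤ : a + b ≤ 2 * q + 1
  a+b≤ = s≤s⁻¹ (subst (a + b <_) (+-suc (2 * q) 1) (≰⇒> a+b≰))
  identity₁ : ∀ q → 2 * (5 * q + 1) ≡ 2 + 5 * (2 * q)
  identity₁ = solve-∀
  2q+1≤a+b : 2 * q + 1 ≤ a + b
  2q+1≤a+b = subst (_≤ a + b) (+-comm 1 (2 * q)) (*-cancelˡ-< 5 (2 * q) (a + b)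
               (<-≤-trans (m<n+m (5 * (2 * q)) {2} z<s) (≤-trans (≤-reflexive (sym (identity₁ q))) (2m≤5[a+b] sizes))))
  identity₂ : ∀ q → 5 * q + 1 ≡ 2 * q + 1 + 3 * q
  identity₂ = solve-∀
  third : ∀ {c} → 5 * q + 1 ≤ 2 * q + 1 + 3 * c → q ≤ c
  third {c} le = *-cancelˡ-≤ 3 (+-cancelˡ-≤ (2 * q + 1) _ _ (≤-trans (≤-reflexive (sym (identity₂ q))) le))
  5q+1≡ : ∀ {c} → c ≡ q → 5 * q + 1 ≡ suc (5 * c)
  5q+1≡ c≡q = trans (+-comm (5 * q) 1) (cong (λ c → suc (5 * c)) (sym c≡q))
  not-tight : (a ≡ q × b ≡ suc q) ⊎ (a ≡ suc q × b ≡ q) → ⊥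
  not-tight (inj₁ (a≡q , b≡1+q)) = ¬tight₁ (5q+1≡ a≡q) (trans b≡1+q (cong suc (sym a≡q)))
  not-tight (inj₂ (a≡1+q , b≡q)) = ¬tight₂ (5q+1≡ b≡q) (trans a≡1+q (cong suc (sym b≡q)))

sizes-5q+2 : ∀ {q a b} → DominatingSizes (5 * q + 2) a b → 2 * q + 2 ≤ a + b
sizes-5q+2 {q} {a} {b} sizes with 2 * q + 2 ≤? a + b
... | yes ok = ok
... | no a+b≰ = ⊥-elim (a+b≰ (begin
  2 * q + 2     ≡⟨ identity₂ q ⟩
  suc q + suc q ≤⟨ +-mono-≤ (third {a} (m≤s+3a sizes a+b≤)) (third {b} (m≤s+3b sizes a+b≤)) ⟩
  a + b         ∎))
  where
  open ≤-Reasoning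
  a+b≤ : a + b ≤ 2 * q + 1
  a+b≤ = s≤s⁻¹ (subst (a + b <_) (+-suc (2 * q) 1) (≰⇒> a+b≰))
  identity₁ : ∀ q → 2 * q + 1 + suc (3 * q) ≡ 5 * q + 2
  identity₁ = solve-∀
  identity₂ : ∀ q → 2 * q + 2 ≡ suc q + suc q
  identity₂ = solve-∀
  third : ∀ {c} → 5 * q + 2 ≤ 2 * q + 1 + 3 * c → q < c
  third {c} le = *-cancelˡ-< 3 q c (+-cancelˡ-≤ (2 * q + 1) _ _ (≤-trans (≤-reflexive (identity₁ q)) le))

-- Dominating sets of the optimal size

data Mod5View : ℕ → Set where
  mod5 : ∀ t s → s < 5 → Mod5View (5 * t + s)

mod5-view : ∀ x → Mod5View x
mod5-view x = subst Mod5View (sym x≡) (mod5 (x / 5) (x % 5) (m%n<n x 5))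
  where
  x≡ : x ≡ 5 * (x / 5) + x % 5
  x≡ = trans (m≡m%n+[m/n]*n x 5) (trans (+-comm (x % 5) _) (cong (_+ x % 5) (*-comm (x / 5) 5)))

5t+s<5q+r⇒t<q : ∀ t s q r → r ≤ s → 5 * t + s < 5 * q + r → t < q
5t+s<5q+r⇒t<q t s q r r≤s lt with q ≤? t
... | no q≰t = ≰⇒> q≰t
... | yes q≤t = ⊥-elim (<-irrefl refl (<-≤-trans lt (+-mono-≤ (*-monoʳ-≤ 5 q≤t) r≤s)))

i<q⇒5i+4<5q : ∀ {i q} → i < q → 5 * i + 4 < 5 * q
i<q⇒5i+4<5q {i} i<q = ≤-trans (≤-reflexive (identity i)) (*-monoʳ-≤ 5 i<q)
  where
  identity : ∀ i → suc (5 * i + 4) ≡ 5 * suc i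
  identity = solve-∀

module Construction (m' : ℕ) where
  open Domination m' public

  position : ℕ → Fin m
  position x = x mod m

  toℕ-position : ∀ x → toℕ (position x) ≡ x % m
  toℕ-position x = toℕ-fromℕ< (m%n<n x m)

  position-toℕ : ∀ j → position (toℕ j) ≡ j
  position-toℕ j = toℕ-injective (trans (toℕ-position (toℕ j)) (<⇒%≡ (toℕ<n j)))

  position-injective : ∀ {x y} → x < m → y < m → position x ≡ position y → x ≡ y
  position-injective {x} {y} x<m y<m eq =
    ≡ₘ⇒≡ x y x<m y<m (trans (sym (toℕ-position x)) (trans (cong toℕ eq) (toℕ-position y)))

  position-KStep : ∀ x y k → x + offset k ≡ₘ y → KStep m (position x) (position y)
  position-KStep x y k eq = offset⇒KStep (position x) (position y) k (begin
    (toℕ (position x) + offset k) % m  ≡⟨ cong (λ z → (z + offset k) % m) (toℕ-position x) ⟩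
    (x % m + offset k) % m             ≡⟨ [%+]%≡[+]% x (offset k) ⟩
    (x + offset k) % m                 ≡⟨ eq ⟩
    y % m                              ≡⟨ toℕ-position y ⟨
    toℕ (position y)                   ∎)
    where open ≡-Reasoning

  vertex₁ vertex₂ : Fin m → Vertex m
  vertex₁ j = Fin.zero , j
  vertex₂ j = Fin.suc Fin.zero , j

  Dominated : List (Vertex m) → Vertex m → Set
  Dominated D v = v ∈ D ⊎ ∃[ u ] (u ∈ D × W4Adj m u v)

  -- The dominating sets: (1, 5i) for i < T and (2, 5i + 4) for i < q, plus extra
  -- side-2 vertices patching the wrap-around at m = 5q + r.
  module Candidate (q T : ℕ) (extra : List (Fin m)) where

    positions₁ : List (Fin m)
    positions₁ = applyUpTo (λ i → position (5 * i)) T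

    positions₂ : List (Fin m)
    positions₂ = applyUpTo (λ i → position (5 * i + 4)) q ++ extra

    D : List (Vertex m)
    D = map vertex₁ positions₁ ++ map vertex₂ positions₂

    length-D : length D ≡ T + (q + length extra)
    length-D = begin
      length D   ≡⟨ length-++ (map vertex₁ positions₁) ⟩
      length (map vertex₁ positions₁) + length (map vertex₂ positions₂)
                 ≡⟨ cong₂ _+_ (length-map _ positions₁) (length-map _ positions₂) ⟩
      length positions₁ + length positions₂
                 ≡⟨ cong₂ _+_ (length-applyUpTo _ T) (trans (length-++ (applyUpTo _ q)) (cong (_+ _) (length-applyUpTo _ q))) ⟩
      T + (q + length extra) ∎
      where open ≡-Reasoning

    ∈D₁ : ∀ {t} → t < T → vertex₁ (position (5 * t)) ∈ D
    ∈D₁ t<T = ∈-++⁺ˡ (∈-map⁺ vertex₁ (∈-applyUpTo⁺ (λ i → position (5 * i)) t<T))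

    ∈D₂ : ∀ {t} → t < q → vertex₂ (position (5 * t + 4)) ∈ D
    ∈D₂ t<q = ∈-++⁺ʳ (map vertex₁ positions₁)
                     (∈-map⁺ vertex₂ (∈-++⁺ˡ (∈-applyUpTo⁺ (λ i → position (5 * i + 4)) t<q)))

    ∈D-extra : ∀ {j} → j ∈ extra → vertex₂ j ∈ D
    ∈D-extra j∈ = ∈-++⁺ʳ (map vertex₁ positions₁)
                         (∈-map⁺ vertex₂ (∈-++⁺ʳ (applyUpTo (λ i → position (5 * i + 4)) q) j∈))

    via₂ : ∀ x y k → vertex₂ (position y) ∈ D → x + offset k ≡ₘ y → Dominated D (vertex₁ (position x))
    via₂ x y k y∈D eq = inj₂ (_ , y∈D , position-KStep x y k eq)

    via₁ : ∀ x y k → vertex₁ (position x) ∈ D → x + offset k ≡ₘ y → Dominated D (vertex₂ (position y))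
    via₁ x y k x∈D eq = inj₂ (_ , x∈D , position-KStep x y k eq)

    -- Each vertex is dominated according to its residue mod 5, except three vertices
    -- near the wrap-around, which are left to the caller.
    module Correctness (r : ℕ) (m≡ : m ≡ 5 * q + r) (r≤2 : r ≤ 2) (m≤5T : m ≤ 5 * T)
                 (boundary₁ : 5 * q + 1 < m → Dominated D (vertex₁ (position (5 * q + 1))))
                 (boundary₂ : ∀ {t} → suc t ≡ q → Dominated D (vertex₁ (position (5 * t + 2))))
                 (boundary₃ : Dominated D (vertex₂ (position 2))) where

      t<T : ∀ t s → 5 * t + s < m → t < T
      t<T t s lt = 5t+s<5q+r⇒t<q t s T 0 z≤n (≤-trans lt (≤-trans m≤5T (≤-reflexive (sym (+-identityʳ (5 * T))))))

      t<q : ∀ t s → 2 ≤ s → 5 * t + s < m → t < q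
      t<q t s 2≤s lt = 5t+s<5q+r⇒t<q t s q r (≤-trans r≤2 2≤s) (subst (5 * t + s <_) m≡ lt)

      m<5[q+1] : m < 5 * suc q + 0
      m<5[q+1] = begin-strict
        m             ≡⟨ m≡ ⟩
        5 * q + r     ≤⟨ +-monoʳ-≤ (5 * q) r≤2 ⟩
        5 * q + 2     <⟨ +-monoʳ-< (5 * q) (s≤s (s≤s (s≤s z≤n))) ⟩
        5 * q + 5     ≡⟨ identity q ⟩
        5 * suc q + 0 ∎
        where
        open ≤-Reasoning
        identity : ∀ q → 5 * q + 5 ≡ 5 * suc q + 0
        identity = solve-∀

      dominated₁ : ∀ {x} → x < m → Dominated D (vertex₁ (position x))
      dominated₁ {x} x<m with mod5-view x
      ... | mod5 t 0 _ = inj₁ (subst (λ z → vertex₁ (position z) ∈ D) (sym (+-identityʳ (5 * t))) (∈D₁ (t<T t 0 x<m)))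
      ... | mod5 t 4 _ = via₂ (5 * t + 4) (5 * t + 4) (# 0) (∈D₂ (t<q t 4 (s≤s (s≤s z≤n)) x<m))
                              (cong (_% m) (+-identityʳ (5 * t + 4)))
      ... | mod5 t 3 _ = via₂ (5 * t + 3) (5 * t + 4) (# 1) (∈D₂ (t<q t 3 (s≤s (s≤s z≤n)) x<m))
                              (cong (_% m) (+-assoc (5 * t) 3 1))
      ... | mod5 t 1 _ with t <? q
      ...   | yes t<q′ = via₂ (5 * t + 1) (5 * t + 4) (# 2) (∈D₂ t<q′) (cong (_% m) (+-assoc (5 * t) 1 3))
      ...   | no t≮q = subst (λ t → Dominated D (vertex₁ (position (5 * t + 1)))) (sym t≡q)
                             (boundary₁ (subst (λ t → 5 * t + 1 < m) t≡q x<m))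
        where
        t≡q : t ≡ q
        t≡q = ≤-antisym (s≤s⁻¹ (5t+s<5q+r⇒t<q t 1 (suc q) 0 z≤n (<-trans x<m m<5[q+1]))) (≮⇒≥ t≮q)
      dominated₁ {x} x<m | mod5 t 2 _ with suc t <? q
      ...   | yes t+1<q = via₂ (5 * t + 2) (5 * suc t + 4) (# 3) (∈D₂ t+1<q) (cong (_% m) (identity t))
        where
        identity : ∀ t → 5 * t + 2 + 7 ≡ 5 * suc t + 4
        identity = solve-∀
      ...   | no t+1≮q = boundary₂ (≤-antisym (t<q t 2 ≤-refl x<m) (≮⇒≥ t+1≮q))
      dominated₁ {x} x<m | mod5 t (suc (suc (suc (suc (suc _))))) (s≤s (s≤s (s≤s (s≤s (s≤s ())))))

      dominated₂ : ∀ {x} → x < m → Dominated D (vertex₂ (position x))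
      dominated₂ {x} x<m with mod5-view x
      ... | mod5 t 4 _ = inj₁ (∈D₂ (t<q t 4 (s≤s (s≤s z≤n)) x<m))
      ... | mod5 t 0 _ = via₁ (5 * t) (5 * t + 0) (# 0) (∈D₁ (t<T t 0 x<m)) refl
      ... | mod5 t 1 _ = via₁ (5 * t) (5 * t + 1) (# 1) (∈D₁ (t<T t 1 x<m)) refl
      ... | mod5 t 3 _ = via₁ (5 * t) (5 * t + 3) (# 2) (∈D₁ (t<T t 3 x<m)) refl
      ... | mod5 zero 2 _ = boundary₃
      ... | mod5 (suc t) 2 _ = via₁ (5 * t) (5 * suc t + 2) (# 3) (∈D₁ (t<T t 7 (subst (_< m) (sym (identity t)) x<m)))
                                    (cong (_% m) (identity t))
        where
        identity : ∀ t → 5 * t + 7 ≡ 5 * suc t + 2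
        identity = solve-∀
      ... | mod5 t (suc (suc (suc (suc (suc _))))) (s≤s (s≤s (s≤s (s≤s (s≤s ())))))

      dominating : IsDominating (W4Adj m) D
      dominating (Fin.zero , j) = subst (Dominated D) (cong vertex₁ (position-toℕ j)) (dominated₁ (toℕ<n j))
      dominating (Fin.suc Fin.zero , j) = subst (Dominated D) (cong vertex₂ (position-toℕ j)) (dominated₂ (toℕ<n j))

      unique : (∀ {i} → i < T → 5 * i < m) → Unique extra →
               (∀ {i} → i < q → ¬ position (5 * i + 4) ∈ extra) → Unique D
      unique 5i<m extra-unique extra-fresh =
        Unique.++⁺ (Unique.map⁺ vertex-injective unique₁)
                   (Unique.map⁺ vertex-injective (Unique.++⁺ unique₂ extra-unique fresh))
                   sides-disjoint
        where
        vertex-injective : ∀ {c} {j j' : Fin m} → (c , j) ≡ (c , j') → j ≡ j'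
        vertex-injective refl = refl
        5i+4<m : ∀ {i} → i < q → 5 * i + 4 < m
        5i+4<m i<q = <-≤-trans (i<q⇒5i+4<5q i<q) (≤-trans (m≤m+n _ r) (≤-reflexive (sym m≡)))
        unique₁ : Unique positions₁
        unique₁ = Unique.applyUpTo⁺₁ _ T (λ {i} {j} i<j j<T eq →
          <⇒≢ i<j (*-cancelˡ-≡ i j 5 (position-injective (5i<m (<-trans i<j j<T)) (5i<m j<T) eq)))
        unique₂ : Unique (applyUpTo (λ i → position (5 * i + 4)) q)
        unique₂ = Unique.applyUpTo⁺₁ _ q (λ {i} {j} i<j j<q eq →
          <⇒≢ i<j (*-cancelˡ-≡ i j 5 (+-cancelʳ-≡ 4 (5 * i) (5 * j)
            (position-injective (5i+4<m (<-trans i<j j<q)) (5i+4<m j<q) eq))))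
        fresh : ∀ {j} → ¬ (j ∈ applyUpTo (λ i → position (5 * i + 4)) q × j ∈ extra)
        fresh (j∈ , j∈extra) with ∈-applyUpTo⁻ (λ i → position (5 * i + 4)) j∈
        ... | i , i<q , refl = extra-fresh i<q j∈extra
        sides-disjoint : ∀ {v} → ¬ (v ∈ map vertex₁ positions₁ × v ∈ map vertex₂ positions₂)
        sides-disjoint (v∈₁ , v∈₂) with ∈-map⁻ vertex₁ v∈₁ | ∈-map⁻ vertex₂ v∈₂
        ... | _ , _ , refl | _ , _ , ()

module Residue (p r : ℕ) where
  q : ℕ
  q = suc (suc p)

  -- With q = 2 + p the number 5q + r is a successor, so m = suc (pred (5q + r)) = 5q + r holds
  -- by computation.
  open Construction (pred (5 * q + r)) public

  8≤m : 8 ≤ m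
  8≤m = ≤-trans (m≤m+n 8 2) (≤-trans (*-monoʳ-≤ 5 (s≤s (s≤s (z≤n {p})))) (m≤m+n (5 * q) r))

  domination-number : ∀ {g} → (∀ {a b} → DominatingSizes m a b → g ≤ a + b) →
                      ∀ D → Unique D → IsDominating (W4Adj m) D → length D ≡ g →
                      DominationNumberIs (W4Adj m) g
  domination-number bound D unique dominating length≡ =
    (D , unique , dominating , length≡) ,
    λ D′ _ dominating′ → ≤-trans (bound (dominating⇒sizes 8≤m dominating′)) (≤-reflexive (sym (length-sides D′)))

5q+r≤5[q+1] : ∀ q {r} → r ≤ 5 → 5 * q + r ≤ 5 * suc q
5q+r≤5[q+1] q {r} r≤5 = ≤-trans (+-monoʳ-≤ (5 * q) r≤5) (≤-reflexive (trans (+-comm (5 * q) 5) (sym (*-suc 5 q))))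

i≤q⇒5i<5q+r : ∀ {i q r} → 1 ≤ r → i < suc q → 5 * i < 5 * q + r
i≤q⇒5i<5q+r {i} {q} {r} 1≤r i<q+1 = <-≤-trans (m<m+n (5 * i) 1≤r) (+-monoˡ-≤ r (*-monoʳ-≤ 5 (s≤s⁻¹ i<q+1)))

length-D≡2q+2 : ∀ q → suc q + (q + 1) ≡ 2 * q + 2
length-D≡2q+2 = solve-∀

module Residue₀ (p : ℕ) where
  open Residue p 0
  open Candidate q q []

  boundary₁ : 5 * q + 1 < m → Dominated D (vertex₁ (position (5 * q + 1)))
  boundary₁ lt = ⊥-elim (<-irrefl refl (<-≤-trans lt (+-monoʳ-≤ (5 * q) z≤n)))

  boundary₂ : ∀ {t} → suc t ≡ q → Dominated D (vertex₁ (position (5 * t + 2)))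
  boundary₂ {t} t+1≡q = via₂ (5 * t + 2) 4 (# 3) (∈D₂ {0} (s≤s z≤n)) (begin
    (5 * t + 2 + 7) % m       ≡⟨ cong (_% m) (identity t) ⟩
    (4 + (5 * suc t + 0)) % m ≡⟨ cong (λ q → (4 + (5 * q + 0)) % m) t+1≡q ⟩
    (4 + m) % m               ≡⟨ [m+n]%n≡m%n 4 m ⟩
    4 % m                     ∎)
    where
    open ≡-Reasoning
    identity : ∀ t → 5 * t + 2 + 7 ≡ 4 + (5 * suc t + 0)
    identity = solve-∀

  boundary₃ : Dominated D (vertex₂ (position 2))
  boundary₃ = via₁ (5 * suc p) 2 (# 3) (∈D₁ ≤-refl) (trans (cong (_% m) (identity p)) ([m+n]%n≡m%n 2 m))
    where
    identity : ∀ p → 5 * suc p + 7 ≡ 2 + (5 * suc (suc p) + 0)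
    identity = solve-∀

  open Correctness 0 refl z≤n (≤-reflexive (+-identityʳ (5 * q))) boundary₁ boundary₂ boundary₃

  γ : DominationNumberIs (W4Adj (5 * q + 0)) (2 * q)
  γ = domination-number (λ {a} {b} sizes → sizes-5q {q} (subst (λ m → DominatingSizes m a b) (+-identityʳ (5 * q)) sizes))
        D (unique (λ i<q → <-≤-trans (*-monoʳ-< 5 i<q) (≤-reflexive (sym (+-identityʳ (5 * q))))) [] (λ _ ()))
        dominating length-D

module Residue₁ (p : ℕ) where
  open Residue p 1
  open Candidate q (suc q) (position (5 * q) ∷ [])

  boundary₁ : 5 * q + 1 < m → Dominated D (vertex₁ (position (5 * q + 1)))
  boundary₁ lt = ⊥-elim (<-irrefl refl lt)

  boundary₂ : ∀ {t} → suc t ≡ q → Dominated D (vertex₁ (position (5 * t + 2)))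
  boundary₂ {t} t+1≡q = via₂ (5 * t + 2) (5 * q) (# 2) (∈D-extra (here refl))
    (cong (_% m) (trans (identity t) (cong (5 *_) t+1≡q)))
    where
    identity : ∀ t → 5 * t + 2 + 3 ≡ 5 * suc t
    identity = solve-∀

  boundary₃ : Dominated D (vertex₂ (position 2))
  boundary₃ = via₁ (5 * q) 2 (# 2) (∈D₁ ≤-refl) (trans (cong (_% m) (identity q)) ([m+n]%n≡m%n 2 m))
    where
    identity : ∀ q → 5 * q + 3 ≡ 2 + (5 * q + 1)
    identity = solve-∀

  open Correctness 1 refl (s≤s z≤n) (5q+r≤5[q+1] q (s≤s z≤n)) boundary₁ boundary₂ boundary₃

  γ : DominationNumberIs (W4Adj (5 * q + 1)) (2 * q + 2)
  γ = domination-number (sizes-5q+1 {q})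
        D (unique (i≤q⇒5i<5q+r ≤-refl) ([] ∷ []) fresh) dominating (trans length-D (length-D≡2q+2 q))
    where
    fresh : ∀ {i} → i < q → ¬ position (5 * i + 4) ∈ position (5 * q) ∷ []
    fresh i<q (here eq) = <⇒≢ (i<q⇒5i+4<5q i<q) (position-injective (<-trans (i<q⇒5i+4<5q i<q) (m<m+n _ z<s)) (m<m+n _ z<s) eq)

module Residue₂ (p : ℕ) where
  open Residue p 2
  open Candidate q (suc q) (position 2 ∷ [])

  2∈D : vertex₂ (position 2) ∈ D
  2∈D = ∈D-extra (here refl)

  boundary₁ : 5 * q + 1 < m → Dominated D (vertex₁ (position (5 * q + 1)))
  boundary₁ _ = via₂ (5 * q + 1) 2 (# 2) 2∈D (trans (cong (_% m) (identity q)) ([m+n]%n≡m%n 2 m))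
    where
    identity : ∀ q → 5 * q + 1 + 3 ≡ 2 + (5 * q + 2)
    identity = solve-∀

  boundary₂ : ∀ {t} → suc t ≡ q → Dominated D (vertex₁ (position (5 * t + 2)))
  boundary₂ {t} t+1≡q = via₂ (5 * t + 2) 2 (# 3) 2∈D (begin
    (5 * t + 2 + 7) % m       ≡⟨ cong (_% m) (identity t) ⟩
    (2 + (5 * suc t + 2)) % m ≡⟨ cong (λ q → (2 + (5 * q + 2)) % m) t+1≡q ⟩
    (2 + m) % m               ≡⟨ [m+n]%n≡m%n 2 m ⟩
    2 % m                     ∎)
    where
    open ≡-Reasoning
    identity : ∀ t → 5 * t + 2 + 7 ≡ 2 + (5 * suc t + 2)
    identity = solve-∀

  open Correctness 2 refl ≤-refl (5q+r≤5[q+1] q (s≤s (s≤s z≤n))) boundary₁ boundary₂ (inj₁ 2∈D)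

  γ : DominationNumberIs (W4Adj (5 * q + 2)) (2 * q + 2)
  γ = domination-number (sizes-5q+2 {q})
        D (unique (i≤q⇒5i<5q+r (s≤s z≤n)) ([] ∷ []) fresh) dominating (trans length-D (length-D≡2q+2 q))
    where
    fresh : ∀ {i} → i < q → ¬ position (5 * i + 4) ∈ position 2 ∷ []
    fresh {i} i<q (here eq) = 4≰2 (subst (4 ≤_) 5i+4≡2 (m≤n+m 4 (5 * i)))
      where
      5i+4≡2 : 5 * i + 4 ≡ 2
      5i+4≡2 = position-injective (<-trans (i<q⇒5i+4<5q i<q) (m<m+n _ z<s)) (≤-trans (s≤s (s≤s (s≤s z≤n))) 8≤m) eq
      4≰2 : ¬ 4 ≤ 2
      4≰2 (s≤s (s≤s ()))

γ-5q : ∀ q → 2 ≤ q → DominationNumberIs (W4Adj (5 * q + 0)) (2 * q)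
γ-5q (suc (suc p)) _ = Residue₀.γ p
γ-5q (suc zero) (s≤s ())

γ-5q+1 : ∀ q → 2 ≤ q → DominationNumberIs (W4Adj (5 * q + 1)) (2 * q + 2)
γ-5q+1 (suc (suc p)) _ = Residue₁.γ p
γ-5q+1 (suc zero) (s≤s ())

γ-5q+2 : ∀ q → 2 ≤ q → DominationNumberIs (W4Adj (5 * q + 2)) (2 * q + 2)
γ-5q+2 (suc (suc p)) _ = Residue₂.γ p
γ-5q+2 (suc zero) (s≤s ())

module _ {n : ℕ} (16≤n : 16 ≤ n) {r : ℕ} (r≤2 : r ≤ 2) (n%10≡2r : n % 10 ≡ 2 * r) where

  n≡2[5q+r] : n ≡ 2 * (5 * (n / 10) + r)
  n≡2[5q+r] = trans (m≡m%n+[m/n]*n n 10) (trans (cong (_+ n / 10 * 10) n%10≡2r) (identity (n / 10) r))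
    where
    identity : ∀ q r → 2 * r + q * 10 ≡ 2 * (5 * q + r)
    identity = solve-∀

  n/2≡5q+r : n / 2 ≡ 5 * (n / 10) + r
  n/2≡5q+r = trans (cong (_/ 2) (trans n≡2[5q+r] (*-comm 2 (5 * (n / 10) + r)))) (m*n/n≡m (5 * (n / 10) + r) 2)

  2≤q : 2 ≤ n / 10
  2≤q with 2 ≤? n / 10
  ... | yes 2≤q′ = 2≤q′
  ... | no 2≰q = ⊥-elim (16≰14 (begin
    16                       ≤⟨ 16≤n ⟩
    n                        ≡⟨ n≡2[5q+r] ⟩
    2 * (5 * (n / 10) + r)   ≤⟨ *-monoʳ-≤ 2 (+-mono-≤ (*-monoʳ-≤ 5 (s≤s⁻¹ (≰⇒> 2≰q))) r≤2) ⟩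
    14                       ∎))
    where
    open ≤-Reasoning
    16≰14 : ¬ 16 ≤ 14
    16≰14 le = 1+n≰n (≤-trans (n≤1+n 15) le)

  from-residue : (g : ℕ → ℕ) → (∀ q → 2 ≤ q → DominationNumberIs (W4Adj (5 * q + r)) (g q)) →
                 DominationNumberIs (W4Adj (n / 2)) (g (n / 10))
  from-residue g γ = subst (λ m → DominationNumberIs (W4Adj m) (g (n / 10))) (sym n/2≡5q+r) (γ (n / 10) 2≤q)

lemma2 : ∀ (n : ℕ) → 2 ∣ n → 16 ≤ n →
           (n % 10 ≡ 0 → DominationNumberIs (W4Adj (n / 2)) (2 * (n / 10)))
           × (n % 10 ≡ 2 ⊎ n % 10 ≡ 4 → DominationNumberIs (W4Adj (n / 2)) (2 * (n / 10) + 2))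
lemma2 n _ 16≤n =
  (λ n%10≡0 → from-residue 16≤n z≤n n%10≡0 (λ q → 2 * q) γ-5q) ,
  [ (λ n%10≡2 → from-residue 16≤n (s≤s z≤n) n%10≡2 (λ q → 2 * q + 2) γ-5q+1)
  , (λ n%10≡4 → from-residue 16≤n ≤-refl n%10≡4 (λ q → 2 * q + 2) γ-5q+2) ]′
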